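{- Let $k,j$ be positive integers with $j \geq 4$. Then $RR(\mathcal{E}(k,j)) \leq \binom{j+1}{2}$. Furthermore, for all positive integers $k \geq \frac{(j^2-2)(j+1)}{2}$, we have $RR(\mathcal{E}(k,j)) = \binom{j+1}{2}$.
   Context: For a positive integer $k$ and an integer $j > -k$, $\mathcal{E}(k,j)$ denotes the equation $x+y+kz=(k+j)w$. A $2$-coloring of $[1,N]=\{1,2,\dots,N\}$ is a map $\chi:[1,N]\to\{0,1\}$; a solution $(x,y,z,w)$ with $x,y,z,w\in[1,N]$ (not necessarily distinct) is monochromatic if $\chi(x)=\chi(y)=\chi(z)=\chi(w)$. For an equation $\mathcal{E}$, $RR(\mathcal{E})$ denotes the minimum positive integer $N$ such that every $2$-coloring of $[1,N]$ admits a monochromatic solution to $\mathcal{E}$ in $[1,N]$. -}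

module Defs where

open import Data.Nat using (ℕ; suc; _+_; _*_; _≤_; _<_)
open import Data.Bool using (Bool)
open import Data.Product using (Σ; _×_; ∃)
open import Relation.Binary.PropositionalEquality using (_≡_)
open import Relation.Nullary using (¬_)

InRange : ℕ → ℕ → Set
InRange N x = 1 ≤ x × x ≤ N

-- 2-colorings of [1,N]: values outside [1,N] are irrelevant
Coloring : Set
Coloring = ℕ → Bool

IsSolution : ℕ → ℕ → ℕ → ℕ → ℕ → ℕ → Set
IsSolution k j x y z w = x + y + k * z ≡ (k + j) * w

MonoSolution : ℕ → ℕ → ℕ → Coloring → Set
MonoSolution k j N χ =
  Σ ℕ λ x → Σ ℕ λ y → Σ ℕ λ z → Σ ℕ λ w →
    InRange N x × InRange N y × InRange N z × InRange N w ×
    IsSolution k j x y z w ×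
    χ x ≡ χ y × χ y ≡ χ z × χ z ≡ χ w

Forces : ℕ → ℕ → ℕ → Set
Forces k j N = (χ : Coloring) → MonoSolution k j N χ

IsRR : ℕ → ℕ → ℕ → Set
IsRR k j N = 1 ≤ N × Forces k j N × ((M : ℕ) → 1 ≤ M → M < N → ¬ Forces k j M)

-- Monochromatic solutions of x + y = j w are solutions of E(k,j) with z = w, so the upper bound follows
-- once every 2-coloring of [1, C(j+1,2)] has one.  Call the color of 1 red; 1 + (j - 1) = j makes j - 1
-- blue.  If j + 1 is blue, the solutions 1 + (jn - 1) = jn and (j + 1) + (jn - 1) = j(n + 1) make
-- 1, 2, ..., ceil(j/2) red, and floor(j/2) + ceil(j/2) = j is a red solution.  If j + 1 is red, then
-- N = C(j+1,2) is blue (N + N = j(j + 1)) and u = C(j,2) = N - j is red (u + u = j(j - 1)); the identity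
-- u + (y + j) = N + y carries redness down the residue class of u modulo j, and the bottom of that class
-- yields a red solution (at once for even j, after a few more forced colors for odd j).
-- Conversely, if 2k >= (j^2 - 2)(j + 1) every solution in [1, C(j+1,2) - 1] has z = w, and that interval
-- has a 2-coloring without monochromatic solutions of x + y = j w.  For arbitrary k the least forcing N
-- exists because forcing is monotone in N and decidable by enumerating the colorings of [1, N].

module Submission where

open import Defs
open import Data.Bool using (Bool; true; false; not)
open import Data.Bool.Properties using (not-involutive; ¬-not) renaming (_≟_ to _≟ᵇ_)
open import Data.Empty using (⊥; ⊥-elim)
open import Data.List using ([]; _∷_)
open import Data.Nat using (ℕ; zero; suc; _+_; _*_; _∸_; _≤_; _<_; z≤n; s≤s; _≟_; _≤?_; anyUpTo?)
open import Data.Nat.Combinatorics using (_C_; nCk+nC[k+1]≡[n+1]C[k+1]; nC1≡n)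
open import Data.Nat.Properties
open import Data.Nat.Tactic.RingSolver using (solve; solve-∀)
open import Data.Product using (Σ; _×_; _,_; proj₁; proj₂; ∃)
open import Data.Sum using (_⊎_; inj₁; inj₂)
open import Relation.Binary.PropositionalEquality
open import Relation.Binary.Definitions using (tri<; tri≈; tri>)
open import Relation.Nullary using (¬_; Dec; yes; no)
open import Relation.Nullary.Decidable using (map′; _×-dec_; from-no; decidable-stable)

m+n≡o⇒m≤o : ∀ {m o} n → m + n ≡ o → m ≤ o
m+n≡o⇒m≤o n eq = m+n≤o⇒m≤o _ (≤-reflexive eq)

m+m≤n+n⇒m≤n : ∀ {m n} → m + m ≤ n + n → m ≤ n
m+m≤n+n⇒m≤n {m} {n} m+m≤n+n with m ≤? n
... | yes m≤n = m≤n
... | no m≰n = ⊥-elim (<⇒≱ (+-mono-< n<m n<m) m+m≤n+n)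
  where
  n<m : n < m
  n<m = ≰⇒> m≰n

m+m≡n+n⇒m≡n : ∀ {m n} → m + m ≡ n + n → m ≡ n
m+m≡n+n⇒m≡n eq = ≤-antisym (m+m≤n+n⇒m≤n (≤-reflexive eq)) (m+m≤n+n⇒m≤n (≤-reflexive (sym eq)))

downward-induction : ∀ {P : ℕ → Set} {E} → P E → (∀ {e} → e < E → P (suc e) → P e) →
                     ∀ {e} → e ≤ E → P e
downward-induction {P} {E} pE step e≤E = go _ (m+[n∸m]≡n e≤E)
  where
  go : ∀ {e} d → e + d ≡ E → P e
  go {e} zero e+0≡E = subst P (trans (sym e+0≡E) (+-identityʳ e)) pE
  go {e} (suc d) e+1+d≡E = step (m+n≡o⇒m≤o d 1+e+d≡E) (go d 1+e+d≡E)
    where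
    1+e+d≡E : suc e + d ≡ E
    1+e+d≡E = trans (sym (+-suc e d)) e+1+d≡E


∃-inRange? : ∀ {P : ℕ → Set} → (∀ x → Dec (P x)) → ∀ N → Dec (∃ λ x → InRange N x × P x)
∃-inRange? {P} P? N = map′ to from (anyUpTo? (λ x → (1 ≤? x) ×-dec P? x) (suc N))
  where
  to : (∃ λ x → x < suc N × 1 ≤ x × P x) → ∃ λ x → InRange N x × P x
  to (x , s≤s x≤N , 1≤x , px) = x , (1≤x , x≤N) , px
  from : (∃ λ x → InRange N x × P x) → ∃ λ x → x < suc N × 1 ≤ x × P x
  from (x , (1≤x , x≤N) , px) = x , s≤s x≤N , 1≤x , px

monoSolution? : ∀ k j N χ → Dec (MonoSolution k j N χ)
monoSolution? k j N χ = map′ to from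
  (∃-inRange? (λ x → ∃-inRange? (λ y → ∃-inRange? (λ z → ∃-inRange? (λ w →
     (_ ≟ _) ×-dec (χ x ≟ᵇ χ y) ×-dec (χ y ≟ᵇ χ z) ×-dec (χ z ≟ᵇ χ w)) N) N) N) N)
  where
  Nested : Set
  Nested = ∃ λ x → InRange N x × ∃ λ y → InRange N y × ∃ λ z → InRange N z × ∃ λ w → InRange N w ×
             IsSolution k j x y z w × χ x ≡ χ y × χ y ≡ χ z × χ z ≡ χ w
  to : Nested → MonoSolution k j N χ
  to (x , x∈ , y , y∈ , z , z∈ , w , w∈ , s) = x , y , z , w , x∈ , y∈ , z∈ , w∈ , s
  from : MonoSolution k j N χ → Nested
  from (x , y , z , w , x∈ , y∈ , z∈ , w∈ , s) = x , x∈ , y , y∈ , z , z∈ , w , w∈ , s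

monoSolution-mono : ∀ {k j M N χ} → M ≤ N → MonoSolution k j M χ → MonoSolution k j N χ
monoSolution-mono {M = M} {N} M≤N (x , y , z , w , x∈ , y∈ , z∈ , w∈ , s) =
  x , y , z , w , wider x∈ , wider y∈ , wider z∈ , wider w∈ , s
  where
  wider : ∀ {a} → InRange M a → InRange N a
  wider (1≤a , a≤M) = 1≤a , ≤-trans a≤M M≤N

forces-mono : ∀ {k j M N} → M ≤ N → Forces k j M → Forces k j N
forces-mono {k} {j} M≤N forces χ = monoSolution-mono {k} {j} M≤N (forces χ)

AgreeOn : ℕ → Coloring → Coloring → Set
AgreeOn N χ χ′ = ∀ {x} → InRange N x → χ x ≡ χ′ x

monoSolution-agree : ∀ {k j N χ χ′} → AgreeOn N χ χ′ → MonoSolution k j N χ → MonoSolution k j N χ′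
monoSolution-agree {N = N} {χ} {χ′} χ≐χ′ (x , y , z , w , x∈ , y∈ , z∈ , w∈ , s , x~y , y~z , z~w) =
  x , y , z , w , x∈ , y∈ , z∈ , w∈ , s , transfer x∈ y∈ x~y , transfer y∈ z∈ y~z , transfer z∈ w∈ z~w
  where
  transfer : ∀ {a b} → InRange N a → InRange N b → χ a ≡ χ b → χ′ a ≡ χ′ b
  transfer a∈ b∈ a~b = trans (sym (χ≐χ′ a∈)) (trans a~b (χ≐χ′ b∈))

recolor : Coloring → ℕ → Bool → Coloring
recolor χ n b x with x ≟ n
... | yes _ = b
... | no _ = χ x

recolor-self : ∀ χ n x → recolor χ n (χ n) x ≡ χ x
recolor-self χ n x with x ≟ n
... | yes refl = refl
... | no _ = refl

recolor-agree : ∀ {N χ χ′} b → AgreeOn N χ χ′ →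
                AgreeOn (suc N) (recolor χ (suc N) b) (recolor χ′ (suc N) b)
recolor-agree {N} {χ} {χ′} b χ≐χ′ {x} (1≤x , x≤1+N) with x ≟ suc N
... | yes _ = refl
... | no x≢1+N = χ≐χ′ (1≤x , ≤-pred (≤∧≢⇒< x≤1+N x≢1+N))

∀-coloring? : ∀ N {P : Coloring → Set} → (∀ {χ χ′} → AgreeOn N χ χ′ → P χ → P χ′) →
              (∀ χ → Dec (P χ)) → Dec (∀ χ → P χ)
∀-coloring? zero P-agree P? =
  map′ (λ p χ → P-agree (λ (1≤x , x≤0) → ⊥-elim (<⇒≱ 1≤x x≤0)) p) (λ ∀p → ∀p _) (P? (λ _ → false))
∀-coloring? (suc N) {P} P-agree P? = map′ from-both to-both (∀-coloring? N {Both} Both-agree Both?)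
  where
  Both : Coloring → Set
  Both χ = P (recolor χ (suc N) true) × P (recolor χ (suc N) false)
  Both-agree : ∀ {χ χ′} → AgreeOn N χ χ′ → Both χ → Both χ′
  Both-agree χ≐χ′ (p , q) = P-agree (recolor-agree true χ≐χ′) p , P-agree (recolor-agree false χ≐χ′) q
  Both? : ∀ χ → Dec (Both χ)
  Both? χ = P? _ ×-dec P? _
  pick : ∀ {χ} b → Both χ → P (recolor χ (suc N) b)
  pick true = proj₁
  pick false = proj₂
  from-both : (∀ χ → Both χ) → ∀ χ → P χ
  from-both ∀both χ = P-agree (λ {x} _ → recolor-self χ (suc N) x) (pick (χ (suc N)) (∀both χ))
  to-both : (∀ χ → P χ) → ∀ χ → Both χ
  to-both ∀p χ = ∀p _ , ∀p _

forces? : ∀ k j N → Dec (Forces k j N)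
forces? k j N = ∀-coloring? N (monoSolution-agree {k} {j}) (monoSolution? k j N)

-- IsRR k j is definitionally LeastPositive (Forces k j).
LeastPositive : (ℕ → Set) → ℕ → Set
LeastPositive P N = 1 ≤ N × P N × ((M : ℕ) → 1 ≤ M → M < N → ¬ P M)

leastPositive : ∀ {P : ℕ → Set} → (∀ n → Dec (P n)) → (∀ {m n} → m ≤ n → P m → P n) →
                ∀ {T} → 1 ≤ T → P T → Σ ℕ λ N → LeastPositive P N × N ≤ T
leastPositive {P} P? P-mono {suc t} _ = search t
  where
  search : ∀ t → P (suc t) → Σ ℕ λ N → LeastPositive P N × N ≤ suc t
  search zero p = 1 , (≤-refl , p , λ M 1≤M M<1 _ → <⇒≱ M<1 1≤M) , ≤-refl
  search (suc t) p with P? (suc t)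
  ... | yes p′ = let N , least , N≤1+t = search t p′ in N , least , m≤n⇒m≤1+n N≤1+t
  ... | no ¬p′ = suc (suc t) , (s≤s z≤n , p , λ M _ M<2+t pM → ¬p′ (P-mono (≤-pred M<2+t) pM)) , ≤-refl

MonoSumSolution : ℕ → ℕ → Coloring → Set
MonoSumSolution j N χ = Σ ℕ λ x → Σ ℕ λ y → Σ ℕ λ w →
  InRange N x × InRange N y × InRange N w × x + y ≡ j * w × χ x ≡ χ y × χ y ≡ χ w

monoSumSolution? : ∀ j N χ → Dec (MonoSumSolution j N χ)
monoSumSolution? j N χ = map′ to from
  (∃-inRange? (λ x → ∃-inRange? (λ y → ∃-inRange? (λ w →
     (_ ≟ _) ×-dec (χ x ≟ᵇ χ y) ×-dec (χ y ≟ᵇ χ w)) N) N) N)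
  where
  Nested : Set
  Nested = ∃ λ x → InRange N x × ∃ λ y → InRange N y × ∃ λ w → InRange N w ×
             x + y ≡ j * w × χ x ≡ χ y × χ y ≡ χ w
  to : Nested → MonoSumSolution j N χ
  to (x , x∈ , y , y∈ , w , w∈ , s) = x , y , w , x∈ , y∈ , w∈ , s
  from : MonoSumSolution j N χ → Nested
  from (x , y , w , x∈ , y∈ , w∈ , s) = x , x∈ , y , y∈ , w , w∈ , s

monoSumSolution-mono : ∀ {j M N χ} → M ≤ N → MonoSumSolution j M χ → MonoSumSolution j N χ
monoSumSolution-mono {M = M} {N} M≤N (x , y , w , x∈ , y∈ , w∈ , s) =
  x , y , w , wider x∈ , wider y∈ , wider w∈ , s
  where
  wider : ∀ {a} → InRange M a → InRange N a
  wider (1≤a , a≤M) = 1≤a , ≤-trans a≤M M≤N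

monoSum⇒mono : ∀ {k j N χ} → MonoSumSolution j N χ → MonoSolution k j N χ
monoSum⇒mono {k} {j} (x , y , w , x∈ , y∈ , w∈ , x+y≡jw , x~y , y~w) =
  x , y , w , w , x∈ , y∈ , w∈ , w∈ , solution , x~y , y~w , refl
  where
  open ≡-Reasoning
  solution : x + y + k * w ≡ (k + j) * w
  solution = begin
    x + y + k * w  ≡⟨ cong (_+ k * w) x+y≡jw ⟩
    j * w + k * w  ≡⟨ +-comm (j * w) (k * w) ⟩
    k * w + j * w  ≡⟨ *-distribʳ-+ w k j ⟨
    (k + j) * w    ∎

large-k⇒z≡w : ∀ {k j N x y z w} → 2 ≤ j → j * N < 2 + k → InRange N x → InRange N y → InRange N w →
              x + y + k * z ≡ (k + j) * w → z ≡ w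
large-k⇒z≡w {k} {j} {N} {x} {y} {z} {w} 2≤j jN<2+k (1≤x , x≤N) (1≤y , y≤N) (1≤w , w≤N) sol with <-cmp z w
... | tri≈ _ z≡w _ = z≡w
... | tri< z<w _ _ = ⊥-elim (<⇒≱ x+y<k+j k+j≤x+y)
  where
  open ≤-Reasoning
  x+y<k+j : x + y < k + j
  x+y<k+j = begin-strict
    x + y  ≤⟨ +-mono-≤ x≤N y≤N ⟩
    N + N  ≡⟨ cong (N +_) (+-identityʳ N) ⟨
    2 * N  ≤⟨ *-monoˡ-≤ N 2≤j ⟩
    j * N  <⟨ jN<2+k ⟩
    2 + k  ≤⟨ ≤-reflexive (+-comm 2 k) ⟩
    k + 2  ≤⟨ +-monoʳ-≤ k 2≤j ⟩
    k + j  ∎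
  k+j≤x+y : k + j ≤ x + y
  k+j≤x+y = +-cancelˡ-≤ (k * z) _ _ (begin
    k * z + (k + j)      ≡⟨ solve (k ∷ j ∷ z ∷ []) ⟩
    k * suc z + j * 1    ≤⟨ +-mono-≤ (*-monoʳ-≤ k z<w) (*-monoʳ-≤ j 1≤w) ⟩
    k * w + j * w        ≡⟨ *-distribʳ-+ w k j ⟨
    (k + j) * w          ≡⟨ sol ⟨
    x + y + k * z        ≡⟨ +-comm (x + y) (k * z) ⟩
    k * z + (x + y)      ∎)
... | tri> _ _ w<z = ⊥-elim (<⇒≱ jw<x+y+k x+y+k≤jw)
  where
  open ≤-Reasoning
  jw<x+y+k : j * w < x + y + k
  jw<x+y+k = begin-strict
    j * w      ≤⟨ *-monoʳ-≤ j w≤N ⟩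
    j * N      <⟨ jN<2+k ⟩
    2 + k      ≤⟨ +-monoˡ-≤ k (+-mono-≤ 1≤x 1≤y) ⟩
    x + y + k  ∎
  x+y+k≤jw : x + y + k ≤ j * w
  x+y+k≤jw = +-cancelˡ-≤ (k * w) _ _ (begin
    k * w + (x + y + k)    ≡⟨ solve (k ∷ w ∷ x ∷ y ∷ []) ⟩
    x + y + k * suc w      ≤⟨ +-monoʳ-≤ (x + y) (*-monoʳ-≤ k w<z) ⟩
    x + y + k * z          ≡⟨ sol ⟩
    (k + j) * w            ≡⟨ *-distribʳ-+ w k j ⟩
    k * w + j * w          ∎)

mono⇒monoSum : ∀ {k j N χ} → 2 ≤ j → j * N < 2 + k → MonoSolution k j N χ → MonoSumSolution j N χ
mono⇒monoSum {k} {j} 2≤j jN<2+k (x , y , z , w , x∈ , y∈ , z∈ , w∈ , sol , x~y , y~z , z~w) =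
  x , y , w , x∈ , y∈ , w∈ , x+y≡jw , x~y , trans y~z z~w
  where
  z≡w : z ≡ w
  z≡w = large-k⇒z≡w 2≤j jN<2+k x∈ y∈ w∈ sol
  x+y≡jw : x + y ≡ j * w
  x+y≡jw = +-cancelʳ-≡ (k * w) (x + y) (j * w) (begin
    x + y + k * w   ≡⟨ cong (λ t → x + y + k * t) z≡w ⟨
    x + y + k * z   ≡⟨ sol ⟩
    (k + j) * w     ≡⟨ *-distribʳ-+ w k j ⟩
    k * w + j * w   ≡⟨ +-comm (k * w) (j * w) ⟩
    j * w + k * w   ∎)
    where open ≡-Reasoning

-- j = 4 + m, u = C(j,2) and N = u + j = C(j+1,2); red is the color of 1.
module FreeColoring (m u : ℕ) (u+u≡ : u + u ≡ (4 + m) * (3 + m)) (χ : Coloring)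
               (free : ¬ MonoSumSolution (4 + m) (u + (4 + m)) χ) where

  N : ℕ
  N = u + (4 + m)

  Red Blue : ℕ → Set
  Red n = χ n ≡ χ 1
  Blue n = χ n ≡ not (χ 1)

  red-of-not-not : ∀ {n} → χ n ≡ not (not (χ 1)) → Red n
  red-of-not-not χn≡ = trans χn≡ (not-involutive (χ 1))

  1≤u : 1 ≤ u
  1≤u = n≢0⇒n>0 λ u≡0 → 0≢1+n (subst (λ t → t + t ≡ (4 + m) * (3 + m)) u≡0 u+u≡)

  u∈ : InRange N u
  u∈ = 1≤u , m≤m+n u (4 + m)

  N∈ : InRange N N
  N∈ = ≤-trans 1≤u (m≤m+n u (4 + m)) , ≤-refl

  below-u∈ : ∀ {x} → 1 ≤ x → x ≤ u → InRange N x
  below-u∈ 1≤x x≤u = 1≤x , ≤-trans x≤u (m≤m+n u (4 + m))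

  above-u∈ : ∀ {x} → 1 ≤ x → x ≤ 4 + m → InRange N (u + x)
  above-u∈ {x} 1≤x x≤j = ≤-trans 1≤x (m≤n+m x u) , +-monoʳ-≤ u x≤j

  small∈ : ∀ {x} → 1 ≤ x → x ≤ 5 + m → InRange N x
  small∈ 1≤x x≤j+1 = 1≤x , ≤-trans x≤j+1 (+-monoˡ-≤ (4 + m) 1≤u)

  1∈ : InRange N 1
  1∈ = small∈ ≤-refl (s≤s z≤n)

  multiple≤u : ∀ {n} → n + n ≤ 3 + m → (4 + m) * n ≤ u
  multiple≤u {n} n+n≤i = m+m≤n+n⇒m≤n (begin
    (4 + m) * n + (4 + m) * n  ≡⟨ *-distribˡ-+ (4 + m) n n ⟨
    (4 + m) * (n + n)          ≤⟨ *-monoʳ-≤ (4 + m) n+n≤i ⟩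
    (4 + m) * (3 + m)          ≡⟨ u+u≡ ⟨
    u + u                      ∎)
    where open ≤-Reasoning

  w∈ : ∀ {x y w} → InRange N x → InRange N y → x + y ≡ (4 + m) * w → InRange N w
  w∈ {x} {y} {w} (1≤x , x≤N) (_ , y≤N) x+y≡jw = 1≤w , w≤N
    where
    1≤w : 1 ≤ w
    1≤w = n≢0⇒n>0 λ { refl → <⇒≱ 1≤x (m+n≡o⇒m≤o y (trans x+y≡jw (*-zeroʳ (4 + m)))) }
    w≤N : w ≤ N
    w≤N = m+m≤n+n⇒m≤n (begin
      w + w           ≤⟨ +-monoʳ-≤ w (m≤m+n w _) ⟩
      (4 + m) * w     ≡⟨ x+y≡jw ⟨
      x + y           ≤⟨ +-mono-≤ x≤N y≤N ⟩
      N + N           ∎)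
      where open ≤-Reasoning

  no-mono : ∀ {x y w} → InRange N x → InRange N y → x + y ≡ (4 + m) * w → χ x ≡ χ y → χ y ≡ χ w → ⊥
  no-mono x∈ y∈ eq x~y y~w = free (_ , _ , _ , x∈ , y∈ , w∈ x∈ y∈ eq , eq , x~y , y~w)

  opposite-w : ∀ {x y w d} → InRange N x → InRange N y → x + y ≡ (4 + m) * w →
               χ x ≡ d → χ y ≡ d → χ w ≡ not d
  opposite-w x∈ y∈ eq x≡d y≡d =
    ¬-not λ w≡d → no-mono x∈ y∈ eq (trans x≡d (sym y≡d)) (trans y≡d (sym w≡d))

  opposite-y : ∀ {x y w d} → InRange N x → InRange N y → x + y ≡ (4 + m) * w →
               χ x ≡ d → χ w ≡ d → χ y ≡ not d
  opposite-y x∈ y∈ eq x≡d w≡d =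
    ¬-not λ y≡d → no-mono x∈ y∈ eq (trans x≡d (sym y≡d)) (trans y≡d (sym w≡d))

  opposite-double : ∀ {x w d} → InRange N x → x + x ≡ (4 + m) * w → χ w ≡ d → χ x ≡ not d
  opposite-double x∈ eq w≡d = ¬-not λ x≡d → no-mono x∈ x∈ eq refl (trans x≡d (sym w≡d))

  j-1-blue : Blue (3 + m)
  j-1-blue = opposite-y 1∈ (small∈ (s≤s z≤n) (≤-trans (n≤1+n _) (n≤1+n _))) (solve (m ∷ [])) refl refl

  -- a = floor(j/2) and L = ceil(j/2).
  module CaseA (j+1-blue : Blue (5 + m)) (a L : ℕ) (a+L≡j : a + L ≡ 4 + m)
               (1≤a : 1 ≤ a) (a≤L : a ≤ L) (L+L≤j+1 : L + L ≤ 5 + m) where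

    red-step : ∀ {n} → 2 + n ≤ L → Red (suc n) → Red (2 + n)
    red-step {n} 2+n≤L n+1-red =
      red-of-not-not (opposite-w {w = 2 + n} (small∈ (s≤s z≤n) ≤-refl) y∈ (solve (m ∷ n ∷ [])) j+1-blue y-blue)
      where
      n+n≤i : n + n ≤ 3 + m
      n+n≤i = +-cancelˡ-≤ 4 (n + n) (3 + m) (begin
        4 + (n + n)        ≡⟨ solve (n ∷ []) ⟩
        (2 + n) + (2 + n)  ≤⟨ +-mono-≤ 2+n≤L 2+n≤L ⟩
        L + L              ≤⟨ L+L≤j+1 ⟩
        5 + m              ≤⟨ ≤-trans (n≤1+n _) (n≤1+n _) ⟩
        7 + m              ∎)
        where open ≤-Reasoning
      y∈ : InRange N ((4 + m) * n + (3 + m))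
      y∈ = ≤-trans (s≤s z≤n) (m≤n+m (3 + m) _) , +-mono-≤ (multiple≤u {n} n+n≤i) (n≤1+n (3 + m))
      y-blue : Blue ((4 + m) * n + (3 + m))
      y-blue = opposite-y {w = suc n} 1∈ y∈ (solve (m ∷ n ∷ [])) refl n+1-red

    red-upto-L : ∀ n → suc n ≤ L → Red (suc n)
    red-upto-L zero _ = refl
    red-upto-L (suc n) 2+n≤L = red-step 2+n≤L (red-upto-L n (≤-trans (n≤1+n _) 2+n≤L))

    contradiction : ⊥
    contradiction = no-mono (small∈ 1≤a (≤-trans a≤L L≤j+1)) (small∈ (≤-trans 1≤a a≤L) L≤j+1)
                            (trans a+L≡j (sym (*-identityʳ (4 + m)))) (trans a-red (sym L-red)) L-red
      where
      L≤j+1 : L ≤ 5 + m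
      L≤j+1 = ≤-trans (m≤m+n L L) L+L≤j+1
      red : ∀ {n} → 1 ≤ n → n ≤ L → Red n
      red {suc n} _ = red-upto-L n
      a-red : Red a
      a-red = red 1≤a a≤L
      L-red : Red L
      L-red = red (≤-trans 1≤a a≤L) ≤-refl

  module CaseB (j+1-red : Red (5 + m)) where

    N-blue : Blue N
    N-blue = opposite-double N∈ N+N≡ j+1-red
      where
      N+N≡ : N + N ≡ (4 + m) * (5 + m)
      N+N≡ = begin
        u + (4 + m) + (u + (4 + m))  ≡⟨ solve (u ∷ m ∷ []) ⟩
        u + u + (8 + 2 * m)          ≡⟨ cong (_+ (8 + 2 * m)) u+u≡ ⟩
        (4 + m) * (3 + m) + (8 + 2 * m) ≡⟨ solve (m ∷ []) ⟩
        (4 + m) * (5 + m)            ∎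
        where open ≡-Reasoning

    u-red : Red u
    u-red = red-of-not-not (opposite-double u∈ u+u≡ j-1-blue)

    -- u = jE + r with r + r = s j; if y + j is red, u + (y + j) = N + y = j w forces w blue and y red.
    module Descent (E r s : ℕ) (u≡ : u ≡ (4 + m) * E + r) (r+r≡ : r + r ≡ s * (4 + m)) (1≤r : 1 ≤ r) where

      residue∈ : ∀ {e} → e ≤ E → InRange N ((4 + m) * e + r)
      residue∈ e≤E =
        below-u∈ (≤-trans 1≤r (m≤n+m r _)) (≤-trans (+-monoˡ-≤ r (*-monoʳ-≤ (4 + m) e≤E)) (≤-reflexive (sym u≡)))

      residue-red : ∀ {e} → e ≤ E → Red ((4 + m) * e + r)
      residue-red = downward-induction (subst Red u≡ u-red) step
        where
        step : ∀ {e} → e < E → Red ((4 + m) * suc e + r) → Red ((4 + m) * e + r)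
        step {e} e<E next-red = red-of-not-not (opposite-y N∈ (residue∈ (<⇒≤ e<E)) N+this≡ N-blue w-blue)
          where
          u+next≡ : u + ((4 + m) * suc e + r) ≡ (4 + m) * (E + suc e + s)
          u+next≡ = begin
            u + ((4 + m) * suc e + r)                  ≡⟨ cong (_+ ((4 + m) * suc e + r)) u≡ ⟩
            (4 + m) * E + r + ((4 + m) * suc e + r)    ≡⟨ solve (m ∷ E ∷ e ∷ r ∷ []) ⟩
            (4 + m) * (E + suc e) + (r + r)            ≡⟨ cong ((4 + m) * (E + suc e) +_) r+r≡ ⟩
            (4 + m) * (E + suc e) + s * (4 + m)        ≡⟨ solve (m ∷ E ∷ e ∷ s ∷ []) ⟩
            (4 + m) * (E + suc e + s)                  ∎
            where open ≡-Reasoning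
          N+this≡ : N + ((4 + m) * e + r) ≡ (4 + m) * (E + suc e + s)
          N+this≡ = begin
            u + (4 + m) + ((4 + m) * e + r)  ≡⟨ solve (u ∷ m ∷ e ∷ r ∷ []) ⟩
            u + ((4 + m) * suc e + r)        ≡⟨ u+next≡ ⟩
            (4 + m) * (E + suc e + s)        ∎
            where open ≡-Reasoning
          w-blue : Blue (E + suc e + s)
          w-blue = opposite-w u∈ (residue∈ e<E) u+next≡ u-red next-red

      r-red : Red r
      r-red = subst (λ t → Red (t + r)) (*-zeroʳ (4 + m)) (residue-red z≤n)

-- j = 4 + 2b: the residue of u modulo j is j/2, and u + j/2 = j (j/2).
module Even (b : ℕ) (χ : Coloring)
            (free : ¬ MonoSumSolution (4 + 2 * b) ((2 + b) * (3 + 2 * b) + (4 + 2 * b)) χ) where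

  open FreeColoring (2 * b) ((2 + b) * (3 + 2 * b)) (solve (b ∷ [])) χ free

  contradiction : ⊥
  contradiction with χ (5 + 2 * b) ≟ᵇ χ 1
  ... | no j+1-not-red =
    CaseA.contradiction (¬-not j+1-not-red) (2 + b) (2 + b)
                        (solve (b ∷ [])) (s≤s z≤n) ≤-refl (m+n≡o⇒m≤o 1 (solve (b ∷ [])))
  ... | yes j+1-red = no-mono {w = 2 + b} u∈ half∈ (solve (b ∷ [])) (trans u-red (sym r-red)) refl
    where
    open CaseB j+1-red
    open Descent (1 + b) (2 + b) 1 (solve (b ∷ [])) (solve (b ∷ [])) (s≤s z≤n)
    half∈ : InRange N (2 + b)
    half∈ = small∈ {2 + b} (s≤s z≤n) (m+n≡o⇒m≤o (3 + b) (solve (b ∷ [])))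

-- j = 5 + 2b: u is a multiple of j, so j and j(b + 1) are red; this forces 2, (j + 1)/2 and j - 2
-- blue, then u + 2 and u + j - 2 red, and these two sum to j j.
module Odd (b : ℕ) (χ : Coloring)
           (free : ¬ MonoSumSolution (5 + 2 * b) ((5 + 2 * b) * (2 + b) + (5 + 2 * b)) χ) where

  open FreeColoring (1 + 2 * b) ((5 + 2 * b) * (2 + b)) (solve (b ∷ [])) χ free

  contradiction : ⊥
  contradiction with χ (6 + 2 * b) ≟ᵇ χ 1
  ... | no j+1-not-red =
    CaseA.contradiction (¬-not j+1-not-red) (2 + b) (3 + b)
                        (solve (b ∷ [])) (s≤s z≤n) (n≤1+n _) (≤-reflexive (solve (b ∷ [])))
  ... | yes j+1-red =
    no-mono {w = 5 + 2 * b} x∈ y∈ (solve (b ∷ [])) (trans x-red (sym y-red)) (trans y-red (sym j-red))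
    where
    open CaseB j+1-red
    open Descent (1 + b) (5 + 2 * b) 2 (solve (b ∷ [])) (solve (b ∷ [])) (s≤s z≤n)
    j-red : Red (5 + 2 * b)
    j-red = r-red
    jb+j-red : Red ((5 + 2 * b) * b + (5 + 2 * b))
    jb+j-red = residue-red (n≤1+n b)
    j∈ : InRange N (5 + 2 * b)
    j∈ = small∈ (s≤s z≤n) (n≤1+n _)
    2∈ : InRange N 2
    2∈ = small∈ {2} (s≤s z≤n) (m+n≡o⇒m≤o (4 + 2 * b) (solve (b ∷ [])))
    j-2∈ : InRange N (3 + 2 * b)
    j-2∈ = small∈ {3 + 2 * b} (s≤s z≤n) (m+n≡o⇒m≤o 3 (solve (b ∷ [])))
    x∈ : InRange N ((5 + 2 * b) * (2 + b) + 2)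
    x∈ = above-u∈ {2} (s≤s z≤n) (m+n≡o⇒m≤o (3 + 2 * b) (solve (b ∷ [])))
    y∈ : InRange N ((5 + 2 * b) * (2 + b) + (3 + 2 * b))
    y∈ = above-u∈ {3 + 2 * b} (s≤s z≤n) (m+n≡o⇒m≤o 2 (solve (b ∷ [])))
    two-blue : Blue 2
    two-blue = opposite-w {w = 2} j∈ j∈ (solve (b ∷ [])) j-red j-red
    half-blue : Blue (3 + b)
    half-blue = opposite-w {w = 3 + b} u∈ j∈ (solve (b ∷ [])) u-red j-red
    j-2-blue : Blue (3 + 2 * b)
    j-2-blue = opposite-w {w = 3 + 2 * b} u∈ (residue∈ (n≤1+n b)) (solve (b ∷ [])) u-red jb+j-red
    x-red : Red ((5 + 2 * b) * (2 + b) + 2)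
    x-red = red-of-not-not (opposite-y {w = 3 + b} j-2∈ x∈ (solve (b ∷ [])) j-2-blue half-blue)
    y-red : Red ((5 + 2 * b) * (2 + b) + (3 + 2 * b))
    y-red = red-of-not-not (opposite-y {w = 3 + b} 2∈ y∈ (solve (b ∷ [])) two-blue half-blue)

-- j = 5 + m: blue is [3, j] ∪ [2j - 2, 2j - 1].
module TwoIntervals (m : ℕ) where

  Blue Red : ℕ → Set
  Blue n = (3 ≤ n × n ≤ 5 + m) ⊎ (8 + 2 * m ≤ n × n ≤ 9 + 2 * m)
  Red n = n ≤ 2 ⊎ (6 + m ≤ n × n ≤ 7 + 2 * m) ⊎ 10 + 2 * m ≤ n

  coloring : Coloring
  coloring n with n ≤? 2 | n ≤? 5 + m | n ≤? 7 + 2 * m | n ≤? 9 + 2 * m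
  ... | yes _ | _     | _     | _     = false
  ... | no _  | yes _ | _     | _     = true
  ... | no _  | no _  | yes _ | _     = false
  ... | no _  | no _  | no _  | yes _ = true
  ... | no _  | no _  | no _  | no _  = false

  classes : ∀ n → (coloring n ≡ true × Blue n) ⊎ (coloring n ≡ false × Red n)
  classes n with n ≤? 2 | n ≤? 5 + m | n ≤? 7 + 2 * m | n ≤? 9 + 2 * m
  ... | yes n≤2 | _       | _       | _       = inj₂ (refl , inj₁ n≤2)
  ... | no n≰2  | yes n≤j | _       | _       = inj₁ (refl , inj₁ (≰⇒> n≰2 , n≤j))
  ... | no _    | no n≰j  | yes n≤  | _       = inj₂ (refl , inj₂ (inj₁ (≰⇒> n≰j , n≤)))
  ... | no _    | no _    | no n≰   | yes n≤  = inj₁ (refl , inj₂ (≰⇒> n≰ , n≤))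
  ... | no _    | no _    | no _    | no n≰   = inj₂ (refl , inj₂ (inj₂ (≰⇒> n≰)))

  blue-of : ∀ {n} → coloring n ≡ true → Blue n
  blue-of {n} χn≡true with classes n
  ... | inj₁ (_ , blue) = blue
  ... | inj₂ (χn≡false , _) with trans (sym χn≡true) χn≡false
  ... | ()

  red-of : ∀ {n} → coloring n ≡ false → Red n
  red-of {n} χn≡false with classes n
  ... | inj₂ (_ , red) = red
  ... | inj₁ (χn≡true , _) with trans (sym χn≡false) χn≡true
  ... | ()

  monochromatic-classes : ∀ {x y w} → coloring x ≡ coloring y → coloring y ≡ coloring w →
                          (Blue x × Blue y × Blue w) ⊎ (Red x × Red y × Red w)
  monochromatic-classes {x} {y} {w} x~y y~w with classes w
  ... | inj₁ (χw≡true , blue) =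
    inj₁ (blue-of (trans x~y (trans y~w χw≡true)) , blue-of (trans y~w χw≡true) , blue)
  ... | inj₂ (χw≡false , red) =
    inj₂ (red-of (trans x~y (trans y~w χw≡false)) , red-of (trans y~w χw≡false) , red)

  blue-≥3 : ∀ {n} → Blue n → 3 ≤ n
  blue-≥3 (inj₁ (3≤n , _)) = 3≤n
  blue-≥3 (inj₂ (8+2m≤n , _)) = ≤-trans (s≤s (s≤s (s≤s z≤n))) 8+2m≤n

  blue-≤ : ∀ {n} → Blue n → n ≤ 9 + 2 * m
  blue-≤ (inj₁ (_ , n≤j)) = ≤-trans n≤j (m+n≡o⇒m≤o (4 + m) (solve (m ∷ [])))
  blue-≤ (inj₂ (_ , n≤9+2m)) = n≤9+2m

  no-blue-solution : ∀ {x y w} → Blue x → Blue y → Blue w → x + y ≢ (5 + m) * w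
  no-blue-solution {x} {y} {w} bx by bw x+y≡jw = split bx by
    where
    open ≤-Reasoning
    3j≤x+y : 15 + 3 * m ≤ x + y
    3j≤x+y = begin
      15 + 3 * m   ≡⟨ solve (m ∷ []) ⟩
      (5 + m) * 3  ≤⟨ *-monoʳ-≤ (5 + m) (blue-≥3 bw) ⟩
      (5 + m) * w  ≡⟨ x+y≡jw ⟨
      x + y        ∎
    low+blue<3j : ∀ {a b} → a ≤ 5 + m → Blue b → a + b < 15 + 3 * m
    low+blue<3j {a} {b} a≤j bb = begin-strict
      a + b                 ≤⟨ +-mono-≤ a≤j (blue-≤ bb) ⟩
      5 + m + (9 + 2 * m)   <⟨ m+n≡o⇒m≤o 0 (solve (m ∷ [])) ⟩
      15 + 3 * m            ∎
    split : Blue x → Blue y → ⊥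
    split (inj₁ (_ , x≤j)) _ = <⇒≱ (low+blue<3j x≤j by) 3j≤x+y
    split _ (inj₁ (_ , y≤j)) = <⇒≱ (subst (_< 15 + 3 * m) (+-comm y x) (low+blue<3j y≤j bx)) 3j≤x+y
    split (inj₂ (x≥ , x≤)) (inj₂ (y≥ , y≤)) with w ≤? 3
    ... | yes w≤3 = <⇒≱ (begin-strict
          (5 + m) * w                ≤⟨ *-monoʳ-≤ (5 + m) w≤3 ⟩
          (5 + m) * 3                <⟨ m+n≡o⇒m≤o m (solve (m ∷ [])) ⟩
          (8 + 2 * m) + (8 + 2 * m)  ≤⟨ +-mono-≤ x≥ y≥ ⟩
          x + y                      ∎) (≤-reflexive x+y≡jw)
    ... | no w≰3 = <⇒≱ (begin-strict
          x + y                      ≤⟨ +-mono-≤ x≤ y≤ ⟩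
          (9 + 2 * m) + (9 + 2 * m)  <⟨ m+n≡o⇒m≤o 1 (solve (m ∷ [])) ⟩
          (5 + m) * 4                ≤⟨ *-monoʳ-≤ (5 + m) (≰⇒> w≰3) ⟩
          (5 + m) * w                ∎) (≤-reflexive (sym x+y≡jw))

  j+1≤2j : 6 + m ≤ 10 + 2 * m
  j+1≤2j = m+n≡o⇒m≤o (4 + m) (solve (m ∷ []))

  red-<j+1 : ∀ {n} → Red n → n < 6 + m → n ≤ 2
  red-<j+1 (inj₁ n≤2) _ = n≤2
  red-<j+1 (inj₂ (inj₁ (6+m≤n , _))) n<6+m = ⊥-elim (<⇒≱ n<6+m 6+m≤n)
  red-<j+1 (inj₂ (inj₂ 10+2m≤n)) n<6+m = ⊥-elim (<⇒≱ n<6+m (≤-trans j+1≤2j 10+2m≤n))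

  red-<2j : ∀ {n} → Red n → n < 10 + 2 * m → n ≤ 2 ⊎ 6 + m ≤ n × n ≤ 7 + 2 * m
  red-<2j (inj₁ n≤2) _ = inj₁ n≤2
  red-<2j (inj₂ (inj₁ n∈[j+1,2j-3])) _ = inj₂ n∈[j+1,2j-3]
  red-<2j (inj₂ (inj₂ 10+2m≤n)) n<10+2m = ⊥-elim (<⇒≱ n<10+2m 10+2m≤n)

  no-red-sum-j : ∀ {x y} → 1 ≤ x → 1 ≤ y → Red x → Red y → x + y ≢ 5 + m
  no-red-sum-j {x} {y} 1≤x 1≤y rx ry x+y≡j = <⇒≱ (begin-strict
    x + y    ≤⟨ +-mono-≤ (red-<j+1 rx x<j+1) (red-<j+1 ry y<j+1) ⟩
    4        <⟨ s≤s (s≤s (s≤s (s≤s (s≤s z≤n)))) ⟩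
    5 + m    ∎) (≤-reflexive (sym x+y≡j))
    where
    open ≤-Reasoning
    x<j+1 : x < 6 + m
    x<j+1 = ≤-trans (m<m+n x 1≤y) (≤-trans (≤-reflexive x+y≡j) (n≤1+n _))
    y<j+1 : y < 6 + m
    y<j+1 = ≤-trans (m<n+m y 1≤x) (≤-trans (≤-reflexive x+y≡j) (n≤1+n _))

  no-red-sum-2j : ∀ {x y} → 1 ≤ x → 1 ≤ y → Red x → Red y → x + y ≢ 10 + 2 * m
  no-red-sum-2j {x} {y} 1≤x 1≤y rx ry x+y≡2j =
    split (red-<2j rx (subst (x <_) x+y≡2j (m<m+n x 1≤y))) (red-<2j ry (subst (y <_) x+y≡2j (m<n+m y 1≤x)))
    where
    open ≤-Reasoning
    ≤2j-3 : ∀ {n} → n ≤ 2 ⊎ 6 + m ≤ n × n ≤ 7 + 2 * m → n ≤ 7 + 2 * m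
    ≤2j-3 (inj₁ n≤2) = ≤-trans n≤2 (m+n≡o⇒m≤o (5 + 2 * m) (solve (m ∷ [])))
    ≤2j-3 (inj₂ (_ , n≤)) = n≤
    split : x ≤ 2 ⊎ 6 + m ≤ x × x ≤ 7 + 2 * m → y ≤ 2 ⊎ 6 + m ≤ y × y ≤ 7 + 2 * m → ⊥
    split (inj₁ x≤2) y-class = <⇒≱ (begin-strict
      x + y          ≤⟨ +-mono-≤ x≤2 (≤2j-3 y-class) ⟩
      9 + 2 * m      <⟨ ≤-refl ⟩
      10 + 2 * m     ∎) (≤-reflexive (sym x+y≡2j))
    split x-class (inj₁ y≤2) = <⇒≱ (begin-strict
      x + y          ≤⟨ +-mono-≤ (≤2j-3 x-class) y≤2 ⟩
      7 + 2 * m + 2  <⟨ m+n≡o⇒m≤o 0 (solve (m ∷ [])) ⟩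
      10 + 2 * m     ∎) (≤-reflexive (sym x+y≡2j))
    split (inj₂ (x≥ , _)) (inj₂ (y≥ , _)) = <⇒≱ (begin-strict
      10 + 2 * m       <⟨ m+n≡o⇒m≤o 1 (solve (m ∷ [])) ⟩
      6 + m + (6 + m)  ≤⟨ +-mono-≤ x≥ y≥ ⟩
      x + y            ∎) (≤-reflexive x+y≡2j)

  no-red-solution : ∀ {x y w} → 1 ≤ x → 1 ≤ y → x + y < (5 + m) * (6 + m) →
                    Red x → Red y → Red w → x + y ≢ (5 + m) * w
  no-red-solution {x} {y} {w} 1≤x 1≤y x+y<jj′ rx ry rw x+y≡jw = split-w rw
    where
    large-w : 6 + m ≤ w → ⊥
    large-w 6+m≤w = <⇒≱ x+y<jj′ (begin
      (5 + m) * (6 + m)  ≤⟨ *-monoʳ-≤ (5 + m) 6+m≤w ⟩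
      (5 + m) * w        ≡⟨ x+y≡jw ⟨
      x + y              ∎)
      where open ≤-Reasoning
    small-w : ∀ {v} → v ≤ 2 → x + y ≢ (5 + m) * v
    small-w {0} _ x+y≡0 = <⇒≱ (≤-trans 1≤x (m≤m+n x y)) (≤-reflexive (trans x+y≡0 (*-zeroʳ (5 + m))))
    small-w {1} _ x+y≡j = no-red-sum-j 1≤x 1≤y rx ry (trans x+y≡j (*-identityʳ (5 + m)))
    small-w {2} _ x+y≡2j = no-red-sum-2j 1≤x 1≤y rx ry (trans x+y≡2j (solve (m ∷ [])))
    small-w {suc (suc (suc _))} (s≤s (s≤s ()))
    split-w : Red w → ⊥
    split-w (inj₁ w≤2) = small-w w≤2 x+y≡jw
    split-w (inj₂ (inj₁ (6+m≤w , _))) = large-w 6+m≤w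
    split-w (inj₂ (inj₂ 10+2m≤w)) = large-w (≤-trans j+1≤2j 10+2m≤w)

  avoids : ∀ {N} → suc N + suc N ≤ (5 + m) * (6 + m) → ¬ MonoSumSolution (5 + m) N coloring
  avoids {N} bound (x , y , w , (1≤x , x≤N) , (1≤y , y≤N) , _ , x+y≡jw , x~y , y~w)
    with monochromatic-classes x~y y~w
  ... | inj₁ (bx , by , bw) = no-blue-solution bx by bw x+y≡jw
  ... | inj₂ (rx , ry , rw) = no-red-solution 1≤x 1≤y x+y<jj′ rx ry rw x+y≡jw
    where
    x+y<jj′ : x + y < (5 + m) * (6 + m)
    x+y<jj′ = <-≤-trans (s≤s (+-mono-≤ x≤N (m≤n⇒m≤1+n y≤N))) bound

-- The two-interval coloring fails for j = 4; this one is checked on [1, 9] by search.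
fourColoring : Coloring
fourColoring 2 = true
fourColoring 3 = true
fourColoring 7 = true
fourColoring 8 = true
fourColoring _ = false

fourColoring-avoids : ∀ {N} → suc N + suc N ≤ 4 * 5 → ¬ MonoSumSolution 4 N fourColoring
fourColoring-avoids bound solution =
  from-no (monoSumSolution? 4 9 fourColoring) (monoSumSolution-mono {4} (≤-pred (m+m≤n+n⇒m≤n bound)) solution)

avoiding : ∀ m {N} → suc N + suc N ≤ (4 + m) * (5 + m) → ∃ λ χ → ¬ MonoSumSolution (4 + m) N χ
avoiding zero bound = fourColoring , fourColoring-avoids bound
avoiding (suc m) bound = TwoIntervals.coloring m , TwoIntervals.avoids m bound

data Parity : ℕ → Set where
  even : ∀ b → Parity (2 * b)
  odd  : ∀ b → Parity (1 + 2 * b)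

parity : ∀ m → Parity m
parity zero = even 0
parity (suc m) with parity m
... | even b = odd b
... | odd b = subst Parity 2[1+b]≡2+2b (even (suc b))
  where
  2[1+b]≡2+2b : 2 * suc b ≡ 2 + 2 * b
  2[1+b]≡2+2b = solve (b ∷ [])

C₂-double : ∀ n → (n + 1) C 2 + (n + 1) C 2 ≡ (n + 1) * n
C₂-double zero = refl
C₂-double (suc n) = begin
  (suc n + 1) C 2 + (suc n + 1) C 2
    ≡⟨ cong (λ t → t + t) (nCk+nC[k+1]≡[n+1]C[k+1] (n + 1) 1) ⟨
  ((n + 1) C 1 + (n + 1) C 2) + ((n + 1) C 1 + (n + 1) C 2)
    ≡⟨ cong (λ t → (t + (n + 1) C 2) + (t + (n + 1) C 2)) (nC1≡n (n + 1)) ⟩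
  ((n + 1) + (n + 1) C 2) + ((n + 1) + (n + 1) C 2)
    ≡⟨ interchange (n + 1) ((n + 1) C 2) ⟩
  (n + 1) + (n + 1) + ((n + 1) C 2 + (n + 1) C 2)
    ≡⟨ cong ((n + 1) + (n + 1) +_) (C₂-double n) ⟩
  (n + 1) + (n + 1) + (n + 1) * n
    ≡⟨ solve (n ∷ []) ⟩
  (suc n + 1) * suc n
    ∎
  where
  open ≡-Reasoning
  interchange : ∀ a c → (a + c) + (a + c) ≡ a + a + (c + c)
  interchange = solve-∀

even-forced : ∀ b χ → MonoSumSolution (4 + 2 * b) ((2 + b) * (3 + 2 * b) + (4 + 2 * b)) χ
even-forced b χ = decidable-stable (monoSumSolution? (4 + 2 * b) _ χ) (Even.contradiction b χ)

odd-forced : ∀ b χ → MonoSumSolution (5 + 2 * b) ((5 + 2 * b) * (2 + b) + (5 + 2 * b)) χ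
odd-forced b χ = decidable-stable (monoSumSolution? (5 + 2 * b) _ χ) (Odd.contradiction b χ)

monoSum-forced : ∀ m χ → MonoSumSolution (4 + m) ((4 + m + 1) C 2) χ
monoSum-forced m χ with parity m
... | even b = subst (λ N → MonoSumSolution (4 + 2 * b) N χ) (sym T≡N) (even-forced b χ)
  where
  T≡N : (4 + 2 * b + 1) C 2 ≡ (2 + b) * (3 + 2 * b) + (4 + 2 * b)
  T≡N = m+m≡n+n⇒m≡n (trans (C₂-double (4 + 2 * b)) (solve (b ∷ [])))
... | odd b = subst (λ N → MonoSumSolution (5 + 2 * b) N χ) (sym T≡N) (odd-forced b χ)
  where
  T≡N : (5 + 2 * b + 1) C 2 ≡ (5 + 2 * b) * (2 + b) + (5 + 2 * b)
  T≡N = m+m≡n+n⇒m≡n (trans (C₂-double (5 + 2 * b)) (solve (b ∷ [])))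

-- With N = C(j+1,2) - 1: 2 j N = (j^2 - 2)(j + 1) + 2.
large-k⇒jN<2+k : ∀ m k {N} → ((4 + m) * (4 + m) ∸ 2) * (4 + m + 1) ≤ 2 * k →
                 suc N + suc N ≤ (4 + m) * (5 + m) → (4 + m) * N < 2 + k
large-k⇒jN<2+k m k {N} large bound = s≤s (*-cancelˡ-≤ 2 (+-cancelˡ-≤ (2 * (4 + m)) _ _ (begin
  2 * (4 + m) + 2 * ((4 + m) * N)                      ≡⟨ solve (m ∷ N ∷ []) ⟩
  (4 + m) * (suc N + suc N)                            ≤⟨ *-monoʳ-≤ (4 + m) bound ⟩
  (4 + m) * ((4 + m) * (5 + m))                        ≡⟨ solve (m ∷ []) ⟩
  2 * (4 + m) + (2 + (14 + 8 * m + m * m) * (5 + m))   ≤⟨ +-monoʳ-≤ (2 * (4 + m)) (+-monoʳ-≤ 2 large′) ⟩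
  2 * (4 + m) + (2 + 2 * k)                            ≡⟨ solve (m ∷ k ∷ []) ⟩
  2 * (4 + m) + 2 * (1 + k)                            ∎)))
  where
  open ≤-Reasoning
  j²≡ : (4 + m) * (4 + m) ≡ 2 + (14 + 8 * m + m * m)
  j²≡ = solve (m ∷ [])
  j²∸2≡ : (4 + m) * (4 + m) ∸ 2 ≡ 14 + 8 * m + m * m
  j²∸2≡ = begin-equality
    (4 + m) * (4 + m) ∸ 2              ≡⟨ cong (_∸ 2) j²≡ ⟩
    2 + (14 + 8 * m + m * m) ∸ 2       ≡⟨ m+n∸m≡n 2 (14 + 8 * m + m * m) ⟩
    14 + 8 * m + m * m                 ∎
  large′ : (14 + 8 * m + m * m) * (5 + m) ≤ 2 * k
  large′ = subst (_≤ 2 * k) (cong₂ _*_ j²∸2≡ (+-comm (4 + m) 1)) large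

1≤T : ∀ m → 1 ≤ (4 + m + 1) C 2
1≤T m = n≢0⇒n>0 λ T≡0 → 0≢1+n (trans (sym (cong (λ t → t + t) T≡0)) (C₂-double (4 + m)))

T-forces : ∀ m k → Forces k (4 + m) ((4 + m + 1) C 2)
T-forces m k χ = monoSum⇒mono {k} (monoSum-forced m χ)

below-T⇒double-bound : ∀ m {M} → M < (4 + m + 1) C 2 → suc M + suc M ≤ (4 + m) * (5 + m)
below-T⇒double-bound m {M} M<T = begin
  suc M + suc M                        ≤⟨ +-mono-≤ M<T M<T ⟩
  (4 + m + 1) C 2 + (4 + m + 1) C 2    ≡⟨ C₂-double (4 + m) ⟩
  (4 + m + 1) * (4 + m)                ≡⟨ solve (m ∷ []) ⟩
  (4 + m) * (5 + m)                    ∎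
  where open ≤-Reasoning

below-T-not-forcing : ∀ m k → ((4 + m) * (4 + m) ∸ 2) * (4 + m + 1) ≤ 2 * k →
                      ∀ M → 1 ≤ M → M < (4 + m + 1) C 2 → ¬ Forces k (4 + m) M
below-T-not-forcing m k large M _ M<T forces =
  let χ , free = avoiding m bound in
  free (mono⇒monoSum (s≤s (s≤s z≤n)) (large-k⇒jN<2+k m k large bound) (forces χ))
  where
  bound : suc M + suc M ≤ (4 + m) * (5 + m)
  bound = below-T⇒double-bound m M<T

theorem2 : (j : ℕ) → 4 ≤ j →
    ((k : ℕ) → 1 ≤ k → Σ ℕ λ N → IsRR k j N × N ≤ (j + 1) C 2)
    × ((k : ℕ) → 1 ≤ k → (j * j ∸ 2) * (j + 1) ≤ 2 * k → IsRR k j ((j + 1) C 2))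
theorem2 j 4≤j with m≤n⇒∃[o]m+o≡n 4≤j
... | m , refl =
  (λ k _ → leastPositive (forces? k j) (forces-mono {k} {j}) (1≤T m) (T-forces m k)) ,
  (λ k _ large → 1≤T m , T-forces m k , below-T-not-forcing m k large)
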